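{- Let $A=(A(1),\ldots,A(n))$ be an array of elements of a totally ordered set that is both $2$-sorted and $5$-sorted. Then two inversions of $A$ cannot follow each other: there are no indices $i<j<l$ such that both $(i,j)$ and $(j,l)$ are inversions of $A$.
   Context: An array $A$ is $k$-sorted if $A(i)\le A(i+k)$ for all $1\le i\le n-k$. An inversion of $A$ is a pair $(i,j)$ with $1\le i<j\le n$ and $A(i)>A(j)$. -}

module Defs where

open import Level using (Level)
open import Data.Nat using (ℕ; _+_) renaming (_<_ to _<ℕ_)
open import Relation.Binary.PropositionalEquality using (_≡_)
open import Data.Fin using (Fin; toℕ)
open import Data.Sum using (_⊎_)
open import Data.Product using (_×_)
open import Relation.Binary.Bundles using (StrictTotalOrder)

module _ {c ℓ₁ ℓ₂ : Level} (O : StrictTotalOrder c ℓ₁ ℓ₂) where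
  open StrictTotalOrder O renaming (Carrier to X)

  _≤ₒ_ : X → X → Set _
  x ≤ₒ y = (x < y) ⊎ (x ≈ y)

  -- arrays of length n are functions Fin n → X (0-based indices)
  -- A is k-sorted: A(i) ≤ A(i+k) whenever both indices are in range
  KSorted : {n : ℕ} → ℕ → (Fin n → X) → Set _
  KSorted {n} k A = (i j : Fin n) → toℕ j ≡ toℕ i + k → A i ≤ₒ A j

  Inversion : {n : ℕ} → (Fin n → X) → Fin n → Fin n → Set _
  Inversion A i j = (toℕ i <ℕ toℕ j) × (A j < A i)

-- Being k-sorted is closed under adding gaps (A(i) ≤ A(i+k) ≤ A(i+k+m)), so a
-- 2- and 5-sorted array is d-sorted for every d in the monoid generated by 2 and 5,
-- i.e. for every d except 1 and 3.  Hence every inversion spans a gap of 1 or 3.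
-- Two consecutive inversions (i,j), (j,l) give A(l) < A(j) < A(i) across a gap of
-- 2, 4 or 6, all of which lie in that monoid, contradicting A(i) ≤ A(l).
module Submission where

open import Defs
open import Level using (Level)
open import Data.Nat using (ℕ; suc; _+_) renaming (_<_ to _<ℕ_)
open import Data.Nat.Properties using (+-assoc; +-identityʳ; +-suc; m≤m+n; ≤-trans; ≤-<-trans; <-trans; ≤-reflexive; m≤n⇒∃[o]m+o≡n)
open import Data.Fin using (Fin; toℕ; fromℕ<)
open import Data.Fin.Properties using (toℕ-injective; toℕ-fromℕ<; toℕ<n)
open import Data.Product using (Σ; _×_; _,_)
open import Data.Sum using (_⊎_; inj₁; inj₂)
open import Data.Empty using (⊥-elim)
open import Relation.Nullary using (¬_)
open import Relation.Binary.Bundles using (StrictTotalOrder)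
open import Relation.Binary.PropositionalEquality using (_≡_; refl; sym; trans; cong)
open Relation.Binary.PropositionalEquality.≡-Reasoning

infix 4 _∈⟨_,_⟩

data _∈⟨_,_⟩ : ℕ → ℕ → ℕ → Set where
  0∈  : ∀ {k m} → 0 ∈⟨ k , m ⟩
  k+∈ : ∀ {d k m} → d ∈⟨ k , m ⟩ → k + d ∈⟨ k , m ⟩
  m+∈ : ∀ {d k m} → d ∈⟨ k , m ⟩ → m + d ∈⟨ k , m ⟩

∈⟨2,5⟩-or-1-or-3 : ∀ d → d ∈⟨ 2 , 5 ⟩ ⊎ (d ≡ 1 ⊎ d ≡ 3)
∈⟨2,5⟩-or-1-or-3 0 = inj₁ 0∈
∈⟨2,5⟩-or-1-or-3 1 = inj₂ (inj₁ refl)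
∈⟨2,5⟩-or-1-or-3 2 = inj₁ (k+∈ 0∈)
∈⟨2,5⟩-or-1-or-3 3 = inj₂ (inj₂ refl)
∈⟨2,5⟩-or-1-or-3 4 = inj₁ (k+∈ (k+∈ 0∈))
∈⟨2,5⟩-or-1-or-3 5 = inj₁ (m+∈ 0∈)
∈⟨2,5⟩-or-1-or-3 (suc (suc (suc (suc (suc (suc d)))))) with ∈⟨2,5⟩-or-1-or-3 (4 + d)
... | inj₁ g = inj₁ (k+∈ g)
... | inj₂ (inj₁ ())
... | inj₂ (inj₂ ())

1-or-3+1-or-3∈⟨2,5⟩ : ∀ {a b} → a ≡ 1 ⊎ a ≡ 3 → b ≡ 1 ⊎ b ≡ 3 → a + b ∈⟨ 2 , 5 ⟩
1-or-3+1-or-3∈⟨2,5⟩ (inj₁ refl) (inj₁ refl) = k+∈ 0∈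
1-or-3+1-or-3∈⟨2,5⟩ (inj₁ refl) (inj₂ refl) = k+∈ (k+∈ 0∈)
1-or-3+1-or-3∈⟨2,5⟩ (inj₂ refl) (inj₁ refl) = k+∈ (k+∈ 0∈)
1-or-3+1-or-3∈⟨2,5⟩ (inj₂ refl) (inj₂ refl) = k+∈ (k+∈ (k+∈ 0∈))

split-gap : ∀ {n} (i j : Fin n) k m → toℕ j ≡ toℕ i + (k + m) →
            Σ (Fin n) λ h → toℕ h ≡ toℕ i + k × toℕ j ≡ toℕ h + m
split-gap {n} i j k m j≡i+k+m = h , toℕ-fromℕ< bound , j≡h+m
  where
  i+k+m≡j : toℕ i + k + m ≡ toℕ j
  i+k+m≡j = trans (+-assoc (toℕ i) k m) (sym j≡i+k+m)

  bound : toℕ i + k <ℕ n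
  bound = ≤-<-trans (≤-trans (m≤m+n (toℕ i + k) m) (≤-reflexive i+k+m≡j)) (toℕ<n j)

  h : Fin n
  h = fromℕ< bound

  j≡h+m : toℕ j ≡ toℕ h + m
  j≡h+m = begin
    toℕ j         ≡⟨ sym i+k+m≡j ⟩
    toℕ i + k + m ≡⟨ cong (_+ m) (sym (toℕ-fromℕ< bound)) ⟩
    toℕ h + m     ∎

gap-between : ∀ {n} {i j : Fin n} → toℕ i <ℕ toℕ j → Σ ℕ λ d → toℕ j ≡ toℕ i + d
gap-between {i = i} i<j with m≤n⇒∃[o]m+o≡n i<j
... | d , i+1+d≡j = suc d , sym (trans (+-suc (toℕ i) d) i+1+d≡j)

module _ {c ℓ₁ ℓ₂ : Level} (O : StrictTotalOrder c ℓ₁ ℓ₂) where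
  open StrictTotalOrder O renaming (Carrier to X; trans to <-transₒ)

  ≤ₒ-trans : ∀ {x y z} → _≤ₒ_ O x y → _≤ₒ_ O y z → _≤ₒ_ O x z
  ≤ₒ-trans (inj₁ x<y) (inj₁ y<z) = inj₁ (<-transₒ x<y y<z)
  ≤ₒ-trans (inj₁ x<y) (inj₂ y≈z) = inj₁ (<-respʳ-≈ y≈z x<y)
  ≤ₒ-trans (inj₂ x≈y) (inj₁ y<z) = inj₁ (<-respˡ-≈ (Eq.sym x≈y) y<z)
  ≤ₒ-trans (inj₂ x≈y) (inj₂ y≈z) = inj₂ (Eq.trans x≈y y≈z)

  ≤ₒ⇒≯ : ∀ {x y} → _≤ₒ_ O x y → ¬ (y < x)
  ≤ₒ⇒≯ (inj₁ x<y) y<x = asym x<y y<x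
  ≤ₒ⇒≯ (inj₂ x≈y) y<x = irrefl (Eq.sym x≈y) y<x

  module _ {n : ℕ} (A : Fin n → X) where

    Inversion-trans : ∀ {i j l} → Inversion O A i j → Inversion O A j l → Inversion O A i l
    Inversion-trans (i<j , Aj<Ai) (j<l , Al<Aj) =
      <-trans i<j j<l , <-transₒ Al<Aj Aj<Ai

    KSorted-0 : KSorted O 0 A
    KSorted-0 i j j≡i+0 with toℕ-injective (trans j≡i+0 (+-identityʳ (toℕ i)))
    ... | refl = inj₂ Eq.refl

    KSorted-+ : ∀ {k m} → KSorted O k A → KSorted O m A → KSorted O (k + m) A
    KSorted-+ {k} {m} k-sorted m-sorted i j j≡i+k+m with split-gap i j k m j≡i+k+m
    ... | h , h≡i+k , j≡h+m = ≤ₒ-trans (k-sorted i h h≡i+k) (m-sorted h j j≡h+m)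

    KSorted-∈⟨⟩ : ∀ {k m d} → KSorted O k A → KSorted O m A → d ∈⟨ k , m ⟩ → KSorted O d A
    KSorted-∈⟨⟩ k-sorted m-sorted 0∈      = KSorted-0
    KSorted-∈⟨⟩ k-sorted m-sorted (k+∈ g) = KSorted-+ k-sorted (KSorted-∈⟨⟩ k-sorted m-sorted g)
    KSorted-∈⟨⟩ k-sorted m-sorted (m+∈ g) = KSorted-+ m-sorted (KSorted-∈⟨⟩ k-sorted m-sorted g)

    KSorted⇒¬Inversion : ∀ {d} → KSorted O d A →
                         ∀ i j → toℕ j ≡ toℕ i + d → ¬ Inversion O A i j
    KSorted⇒¬Inversion d-sorted i j j≡i+d (_ , Aj<Ai) = ≤ₒ⇒≯ (d-sorted i j j≡i+d) Aj<Ai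

    inversion-gap-1-or-3 : KSorted O 2 A → KSorted O 5 A → ∀ i j → Inversion O A i j →
                           Σ ℕ λ d → (d ≡ 1 ⊎ d ≡ 3) × toℕ j ≡ toℕ i + d
    inversion-gap-1-or-3 sorted₂ sorted₅ i j inv@(i<j , _) with gap-between i<j
    ... | d , j≡i+d with ∈⟨2,5⟩-or-1-or-3 d
    ...   | inj₁ g   = ⊥-elim
                         (KSorted⇒¬Inversion (KSorted-∈⟨⟩ sorted₂ sorted₅ g) i j j≡i+d inv)
    ...   | inj₂ 1∨3 = d , 1∨3 , j≡i+d

lemma5 : {c ℓ₁ ℓ₂ : Level} (O : StrictTotalOrder c ℓ₁ ℓ₂) {n : ℕ}
         (A : Fin n → StrictTotalOrder.Carrier O) →
         KSorted O 2 A → KSorted O 5 A →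
         (i j l : Fin n) → ¬ (Inversion O A i j × Inversion O A j l)
lemma5 O A sorted₂ sorted₅ i j l (ij , jl)
  with inversion-gap-1-or-3 O A sorted₂ sorted₅ i j ij
     | inversion-gap-1-or-3 O A sorted₂ sorted₅ j l jl
... | a , a∈1,3 , j≡i+a | b , b∈1,3 , l≡j+b =
  KSorted⇒¬Inversion O A (KSorted-∈⟨⟩ O A sorted₂ sorted₅ (1-or-3+1-or-3∈⟨2,5⟩ a∈1,3 b∈1,3))
    i l l≡i+a+b (Inversion-trans O A ij jl)
  where
  l≡i+a+b : toℕ l ≡ toℕ i + (a + b)
  l≡i+a+b = begin
    toℕ l         ≡⟨ l≡j+b ⟩
    toℕ j + b     ≡⟨ cong (_+ b) j≡i+a ⟩
    toℕ i + a + b ≡⟨ +-assoc (toℕ i) a b ⟩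
    toℕ i + (a + b) ∎
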